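{- Let $X\subseteq B^n$ be well-behaved. Then $X^{[i,j]}$, $X^{(i,j)}$ and $X^{\mathbf b}$ are well-behaved for every comparator $[i,j]$ and every exchange $(i,j)$ with $i\neq j\in\{1,\dots,n\}$.
   Context: $B=\{0,1\}$. A comparator $[i,j]$ ($i,j$ distinct, ordered) maps $x\in B^n$ to $x^{[i,j]}$ obtained by replacing $x_i$ by $\min(x_i,x_j)$ and $x_j$ by $\max(x_i,x_j)$; an exchange $(i,j)$ maps $x$ to $x^{(i,j)}$ with entries $i$ and $j$ swapped; $x^{\mathbf b}$ is elementwise Boolean negation. Operations act on sets elementwise: $X^r=\{x^r\mid x\in X\}$. Threshold sets: for a permutation $y$ of $(1,\dots,n)$, $T(y)=\{([y_1\ge k],\dots,[y_n\ge k])\mid 1\le k\le n+1\}$, where $[P]=1$ if $P$ holds and $0$ otherwise. $X\subseteq B^n$ is well-behaved if it is a union of threshold sets. -}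

module Defs where

open import Data.Bool using (Bool; true; false; not; _∧_; _∨_)
open import Data.Nat using (ℕ; suc; _≤_; _≤ᵇ_)
open import Data.Fin using (Fin; toℕ; _≟_)
open import Data.Fin.Permutation using (Permutation′; _⟨$⟩ʳ_)
open import Data.Vec using (Vec; lookup; tabulate; map)
open import Data.Product using (Σ; ∃; _×_; _,_)
open import Relation.Nullary using (¬_; does)
open import Relation.Binary.PropositionalEquality using (_≡_)
open import Relation.Unary using (Pred)
open import Level using (0ℓ)

Bn : ℕ → Set
Bn n = Vec Bool n

Subset : ℕ → Set₁
Subset n = Pred (Bn n) 0ℓ

image : ∀ {n} → (Bn n → Bn n) → Subset n → Subset n
image r X x = ∃ λ z → X z × r z ≡ x

comparator : ∀ {n} → Fin n → Fin n → Bn n → Bn n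
comparator i j x = tabulate λ k →
  if′ does (k ≟ i) then (lookup x i ∧ lookup x j)
  else if′ does (k ≟ j) then (lookup x i ∨ lookup x j)
  else lookup x k
  where
  if′_then_else_ : Bool → Bool → Bool → Bool
  if′ true  then a else b = a
  if′ false then a else b = b

exchange : ∀ {n} → Fin n → Fin n → Bn n → Bn n
exchange i j x = tabulate λ k →
  sel (does (k ≟ i)) (lookup x j) (sel (does (k ≟ j)) (lookup x i) (lookup x k))
  where
  sel : Bool → Bool → Bool → Bool
  sel true  a b = a
  sel false a b = b

negation : ∀ {n} → Bn n → Bn n
negation = map not

-- [P] as a Boolean for P = (m ≥ k)
-- A permutation y of (1,…,n) is a bijection Fin n → Fin n; its i-th entry is
-- y_i = 1 + toℕ (y ⟨$⟩ʳ i) ∈ {1,…,n}.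
entry : ∀ {n} → Permutation′ n → Fin n → ℕ
entry y i = suc (toℕ (y ⟨$⟩ʳ i))

thresholdVec : ∀ {n} → Permutation′ n → ℕ → Bn n
thresholdVec y k = tabulate λ i → k ≤ᵇ entry y i

T : ∀ {n} → Permutation′ n → Subset n
T {n} y x = ∃ λ k → (1 ≤ k) × (k ≤ suc n) × thresholdVec y k ≡ x

-- X is well-behaved: X is a union of threshold sets, i.e. there is a family
-- (given by a predicate on permutations) whose threshold sets have union X.
WellBehaved : ∀ {n} → Subset n → Set₁
WellBehaved {n} X =
  Σ (Pred (Permutation′ n) 0ℓ) λ Y →
    ∀ x → (X x → ∃ λ y → Y y × T y x) × ((∃ λ y → Y y × T y x) → X x)

{-# OPTIONS --safe #-}
-- Every operation in question maps each threshold set onto a threshold set,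
-- and taking images commutes with unions. An exchange (i,j) merely relabels
-- coordinates: it sends T(y) to T(y ∘ (i j)). Every vector of T(y) has
-- x_i ≤ x_j when y_i ≤ y_j, so then the comparator [i,j] fixes T(y) pointwise;
-- otherwise every vector has x_j ≤ x_i and [i,j] acts on T(y) as (i,j).
-- Negation reverses the ranking: the complement of the level-k vector of y is
-- the level-(n+2-k) vector of n+1-y.
module Submission where

open import Defs
open import Data.Nat using (ℕ)
open import Data.Fin using (Fin)
open import Data.Product using (_×_)
open import Relation.Nullary using (¬_)
open import Relation.Binary.PropositionalEquality using (_≡_)

open import Data.Bool as Bool using (true; false; not; _∧_; _∨_; if_then_else_; b≤b; f≤t)
open import Data.Bool.Properties using (∧-idem; ∨-idem; ∧-comm; ∨-comm; ≤-minimum)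
open import Data.Nat as ℕ using (suc; _+_; _∸_; _≤_; _≤ᵇ_; _≤?_)
open import Data.Nat.Properties
  using ( ≤-trans; ≤-total; ≤ᵇ-reflects-≤; +-mono-≤; +-monoˡ-≤; +-cancelˡ-≤; +-suc
        ; 1+n≰n; ≰⇒>; ∸-monoʳ-≤; m<n⇒0<n∸m; m+[n∸m]≡n; m∸[m∸n]≡n; m≤n⇒m≤1+n
        ; module ≤-Reasoning)
open import Data.Fin using (toℕ; opposite; _≟_)
open import Data.Fin.Properties using (toℕ<n; opposite-prop)
open import Data.Fin.Permutation using (Permutation′; _⟨$⟩ʳ_; _∘ₚ_; transpose; reverse)
import Data.Fin.Permutation.Components as PC
open import Data.Vec using (tabulate; lookup)
open import Data.Vec.Properties using (lookup∘tabulate; tabulate-cong; tabulate-∘)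
open import Data.Vec.Relation.Binary.Pointwise.Extensional using (ext; Pointwise-≡⇒≡)
open import Data.Product using (∃; _,_; proj₁; proj₂)
open import Data.Sum using (inj₁; inj₂)
open import Function using (_∘_; _∋_)
open import Level using (0ℓ)
open import Relation.Nullary using (does; yes; no; contradiction)
open import Relation.Nullary.Reflects using (ofʸ; ofⁿ)
open import Relation.Nullary.Decidable using (does-≡; map′; ¬?)
open import Relation.Binary.PropositionalEquality using (refl; sym; trans; cong; subst₂; module ≡-Reasoning)
open import Relation.Unary using (Pred; _⊆_; _≐_)

PreservesThresholdSets : ∀ {n} → (Bn n → Bn n) → Set
PreservesThresholdSets {n} r = ∀ (y : Permutation′ n) → ∃ λ y′ → T y′ ≐ image r (T y)

wellBehaved-image : ∀ {n} {r : Bn n → Bn n} {X : Subset n} →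
  PreservesThresholdSets r → WellBehaved X → WellBehaved (image r X)
wellBehaved-image {n} {r} {X} preserves (Y , X≐⋃T) = Y′ , λ x → ⊆⋃ , ⋃⊆
  where
  Y′ : Pred (Permutation′ n) 0ℓ
  Y′ y′ = ∃ λ y → Y y × T y′ ≐ image r (T y)

  ⊆⋃ : ∀ {x} → image r X x → ∃ λ y′ → Y′ y′ × T y′ x
  ⊆⋃ (z , Xz , rz≡x) with X≐⋃T z .proj₁ Xz
  ... | y , Yy , Tyz with preserves y
  ...   | y′ , Ty′≐rTy = y′ , (y , Yy , Ty′≐rTy) , Ty′≐rTy .proj₂ (z , Tyz , rz≡x)

  ⋃⊆ : ∀ {x} → (∃ λ y′ → Y′ y′ × T y′ x) → image r X x
  ⋃⊆ (y′ , (y , Yy , Ty′≐rTy) , Ty′x) with Ty′≐rTy .proj₁ Ty′x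
  ... | z , Tyz , rz≡x = z , X≐⋃T z .proj₂ (y , Yy , Tyz) , rz≡x

module _ {n} (r : Bn n → Bn n) (y y′ : Permutation′ n) where

  T≐image-of-levelInvolution : (g : ℕ → ℕ) →
    (∀ {k} → 1 ≤ k → k ≤ suc n → 1 ≤ g k × g k ≤ suc n) →
    (∀ {k} → 1 ≤ k → k ≤ suc n → g (g k) ≡ k) →
    (∀ {k} → 1 ≤ k → k ≤ suc n → thresholdVec y′ (g k) ≡ r (thresholdVec y k)) →
    T y′ ≐ image r (T y)
  T≐image-of-levelInvolution g g-level g-involutive matches = T′⊆image , image⊆T′
    where
    T′⊆image : T y′ ⊆ image r (T y)
    T′⊆image (k , 1≤k , k≤1+n , refl) with g-level 1≤k k≤1+n
    ... | 1≤gk , gk≤1+n =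
      thresholdVec y (g k) , (g k , 1≤gk , gk≤1+n , refl) ,
      trans (sym (matches 1≤gk gk≤1+n)) (cong (thresholdVec y′) (g-involutive 1≤k k≤1+n))

    image⊆T′ : image r (T y) ⊆ T y′
    image⊆T′ (_ , (k , 1≤k , k≤1+n , refl) , refl) with g-level 1≤k k≤1+n
    ... | 1≤gk , gk≤1+n = g k , 1≤gk , gk≤1+n , matches 1≤k k≤1+n

  T≐image : (∀ k → thresholdVec y′ k ≡ r (thresholdVec y k)) → T y′ ≐ image r (T y)
  T≐image matches =
    T≐image-of-levelInvolution (λ k → k) _,_ (λ _ _ → refl) (λ {k} _ _ → matches k)

lookup-thresholdVec : ∀ {n} (y : Permutation′ n) k i → lookup (thresholdVec y k) i ≡ (k ≤ᵇ entry y i)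
lookup-thresholdVec y k = lookup∘tabulate (λ i → k ≤ᵇ entry y i)

module _ {n} (i j : Fin n) where

  lookup-exchange : ∀ x k → lookup (exchange i j x) k ≡ lookup x (PC.transpose i j k)
  lookup-exchange x k rewrite (lookup (exchange i j x) k ≡ _) ∋ lookup∘tabulate _ k
    with does (k ≟ i)
  ... | true = refl
  ... | false with does (k ≟ j)
  ...   | true = refl
  ...   | false = refl

  thresholdVec-transpose : ∀ y k → thresholdVec (transpose i j ∘ₚ y) k ≡ exchange i j (thresholdVec y k)
  thresholdVec-transpose y k = Pointwise-≡⇒≡ (ext λ m → begin
    lookup (thresholdVec (transpose i j ∘ₚ y) k) m ≡⟨ lookup-thresholdVec (transpose i j ∘ₚ y) k m ⟩
    k ≤ᵇ entry y (PC.transpose i j m)               ≡⟨ lookup-thresholdVec y k (PC.transpose i j m) ⟨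
    lookup (thresholdVec y k) (PC.transpose i j m)  ≡⟨ lookup-exchange (thresholdVec y k) m ⟨
    lookup (exchange i j (thresholdVec y k)) m      ∎)
    where open ≡-Reasoning

  exchange-preservesThresholdSets : PreservesThresholdSets (exchange i j)
  exchange-preservesThresholdSets y =
    transpose i j ∘ₚ y , T≐image (exchange i j) y (transpose i j ∘ₚ y) (thresholdVec-transpose y)

x≤y⇒x∧y≡x : ∀ {x y} → x Bool.≤ y → x ∧ y ≡ x
x≤y⇒x∧y≡x f≤t = refl
x≤y⇒x∧y≡x {x} b≤b = ∧-idem x

x≤y⇒x∨y≡y : ∀ {x y} → x Bool.≤ y → x ∨ y ≡ y
x≤y⇒x∨y≡y f≤t = refl
x≤y⇒x∨y≡y {x} b≤b = ∨-idem x

≤ᵇ-monoʳ : ∀ k {a b} → a ≤ b → (k ≤ᵇ a) Bool.≤ (k ≤ᵇ b)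
≤ᵇ-monoʳ k {a} {b} a≤b
  with k ≤ᵇ a | ≤ᵇ-reflects-≤ k a | k ≤ᵇ b | ≤ᵇ-reflects-≤ k b
... | false | _ | c | _ = ≤-minimum c
... | true | ofʸ _ | true | ofʸ _ = b≤b
... | true | ofʸ k≤a | false | ofⁿ k≰b = contradiction (≤-trans k≤a a≤b) k≰b

thresholdVec-mono : ∀ {n} (y : Permutation′ n) k {i j} → entry y i ≤ entry y j →
  lookup (thresholdVec y k) i Bool.≤ lookup (thresholdVec y k) j
thresholdVec-mono y k {i} {j} yi≤yj =
  subst₂ Bool._≤_ (sym (lookup-thresholdVec y k i)) (sym (lookup-thresholdVec y k j)) (≤ᵇ-monoʳ k yi≤yj)

module _ {n} (i j : Fin n) where

  lookup-comparator : ∀ x k → lookup (comparator i j x) k ≡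
    (if does (k ≟ i) then lookup x i ∧ lookup x j
     else if does (k ≟ j) then lookup x i ∨ lookup x j
     else lookup x k)
  lookup-comparator x k rewrite (lookup (comparator i j x) k ≡ _) ∋ lookup∘tabulate _ k
    with does (k ≟ i)
  ... | true = refl
  ... | false with does (k ≟ j)
  ...   | true = refl
  ...   | false = refl

  comparator-of-≤ : ∀ x → lookup x i Bool.≤ lookup x j → comparator i j x ≡ x
  comparator-of-≤ x xi≤xj = Pointwise-≡⇒≡ (ext coordinate)
    where
    coordinate : ∀ k → lookup (comparator i j x) k ≡ lookup x k
    coordinate k rewrite lookup-comparator x k with k ≟ i | k ≟ j
    ... | yes refl | _ = x≤y⇒x∧y≡x xi≤xj
    ... | no _ | yes refl = x≤y⇒x∨y≡y xi≤xj
    ... | no _ | no _ = refl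

  comparator-of-≥ : ∀ x → lookup x j Bool.≤ lookup x i → comparator i j x ≡ exchange i j x
  comparator-of-≥ x xj≤xi = Pointwise-≡⇒≡ (ext coordinate)
    where
    coordinate : ∀ k → lookup (comparator i j x) k ≡ lookup (exchange i j x) k
    coordinate k rewrite lookup-comparator x k | lookup-exchange i j x k with does (k ≟ i)
    ... | true = trans (∧-comm (lookup x i) (lookup x j)) (x≤y⇒x∧y≡x xj≤xi)
    ... | false with does (k ≟ j)
    ...   | true = trans (∨-comm (lookup x i) (lookup x j)) (x≤y⇒x∨y≡y xj≤xi)
    ...   | false = refl

  comparator-preservesThresholdSets : PreservesThresholdSets (comparator i j)
  comparator-preservesThresholdSets y with ≤-total (entry y i) (entry y j)
  ... | inj₁ yi≤yj = y , T≐image (comparator i j) y y λ k →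
    sym (comparator-of-≤ (thresholdVec y k) (thresholdVec-mono y k yi≤yj))
  ... | inj₂ yj≤yi = transpose i j ∘ₚ y , T≐image (comparator i j) y (transpose i j ∘ₚ y) λ k →
    trans (thresholdVec-transpose i j y k) (sym (comparator-of-≥ (thresholdVec y k) (thresholdVec-mono y k yj≤yi)))

≤ᵇ-complement : ∀ {e e′ N k k′} → e + e′ ≡ N → k + k′ ≡ suc N → (k′ ≤ᵇ e′) ≡ not (k ≤ᵇ e)
≤ᵇ-complement {e} {e′} {N} {k} {k′} e+e′≡N k+k′≡1+N =
  does-≡ (k′ ≤? e′) (map′ k≰e⇒k′≤e′ k′≤e′⇒k≰e (¬? (k ≤? e)))
  where
  open ≤-Reasoning

  k′≤e′⇒k≰e : k′ ≤ e′ → ¬ k ≤ e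
  k′≤e′⇒k≰e k′≤e′ k≤e = 1+n≰n (begin
    suc N   ≡⟨ sym k+k′≡1+N ⟩
    k + k′  ≤⟨ +-mono-≤ k≤e k′≤e′ ⟩
    e + e′  ≡⟨ e+e′≡N ⟩
    N       ∎)

  k≰e⇒k′≤e′ : ¬ k ≤ e → k′ ≤ e′
  k≰e⇒k′≤e′ k≰e = +-cancelˡ-≤ (suc e) k′ e′ (begin
    suc e + k′  ≤⟨ +-monoˡ-≤ k′ (≰⇒> k≰e) ⟩
    k + k′      ≡⟨ k+k′≡1+N ⟩
    suc N       ≡⟨ cong suc e+e′≡N ⟨
    suc e + e′  ∎)

module _ {n} (y : Permutation′ n) where

  entry-+-entry-reverse : ∀ i → entry y i + entry (y ∘ₚ reverse) i ≡ suc n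
  entry-+-entry-reverse i = begin
    suc a + suc (toℕ (opposite (y ⟨$⟩ʳ i)))  ≡⟨ cong (λ b → suc a + suc b) (opposite-prop (y ⟨$⟩ʳ i)) ⟩
    suc a + suc (n ∸ suc a)                  ≡⟨ +-suc (suc a) (n ∸ suc a) ⟩
    suc (suc a + (n ∸ suc a))                ≡⟨ cong suc (m+[n∸m]≡n (toℕ<n (y ⟨$⟩ʳ i))) ⟩
    suc n                                    ∎
    where
    open ≡-Reasoning
    a : ℕ
    a = toℕ (y ⟨$⟩ʳ i)

  thresholdVec-reverse : ∀ {k} → k ≤ suc (suc n) →
    thresholdVec (y ∘ₚ reverse) (suc (suc n) ∸ k) ≡ negation (thresholdVec y k)
  thresholdVec-reverse {k} k≤2+n =
    trans (tabulate-cong λ i → ≤ᵇ-complement {e = entry y i} {k = k} (entry-+-entry-reverse i) (m+[n∸m]≡n k≤2+n))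
          (tabulate-∘ not (λ i → k ≤ᵇ entry y i))

negation-preservesThresholdSets : ∀ {n} → PreservesThresholdSets {n} negation
negation-preservesThresholdSets {n} y = y ∘ₚ reverse , T≐image-of-levelInvolution negation y (y ∘ₚ reverse)
  (suc (suc n) ∸_)
  (λ 1≤k k≤1+n → m<n⇒0<n∸m (ℕ.s≤s k≤1+n) , ∸-monoʳ-≤ (suc (suc n)) 1≤k)
  (λ _ k≤1+n → m∸[m∸n]≡n (m≤n⇒m≤1+n k≤1+n))
  (λ _ k≤1+n → thresholdVec-reverse y (m≤n⇒m≤1+n k≤1+n))

mainTheorem17 : ∀ (n : ℕ) (X : Subset n) → WellBehaved X →
    ∀ (i j : Fin n) → ¬ (i ≡ j) →
      WellBehaved (image (comparator i j) X)
      × WellBehaved (image (exchange i j) X)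
      × WellBehaved (image negation X)
mainTheorem17 n X wb i j _ =
  wellBehaved-image (comparator-preservesThresholdSets i j) wb ,
  wellBehaved-image (exchange-preservesThresholdSets i j) wb ,
  wellBehaved-image negation-preservesThresholdSets wb
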